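{- Let $\Gamma$ be a minimal prime graph and let $U\subseteq V(\Gamma)$ be a generation site. Then $K=V(\Gamma)\setminus U$ is a clique in $\Gamma$.
   Context: All graphs are finite, simple and undirected; $\overline{\Gamma}$ is the complement of $\Gamma$. A clique is a set of pairwise adjacent vertices. A minimal prime graph is a connected graph $\Gamma$ on two or more vertices such that (1) $\overline{\Gamma}$ is triangle-free, (2) $\overline{\Gamma}$ is 3-colorable, and (3) for every edge $e$ of $\Gamma$, the complement of the graph obtained from $\Gamma$ by deleting $e$ is not both triangle-free and 3-colorable. For a minimal prime graph $\Gamma$, a subset $U\subseteq V(\Gamma)$ is a generation site if the graph $\Gamma'$ obtained from $\Gamma$ by adding a new vertex $w$ and edges $\{w,u\}$ for all $u\in U$ is a minimal prime graph. -}

module Defs where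

open import Data.Nat using (ℕ; suc; _≤_)
open import Data.Fin using (Fin; zero; suc; _≟_)
open import Data.Fin.Subset using (Subset; Side; inside; outside; _∈_; _∉_)
open import Data.Vec using (lookup)
open import Data.Bool using (Bool; true; false; if_then_else_; _∧_; _∨_)
open import Data.Product using (Σ; ∃; _×_; _,_)
open import Relation.Nullary using (¬_)
open import Relation.Nullary.Decidable using (⌊_⌋)
open import Relation.Binary.PropositionalEquality using (_≡_; _≢_; refl)

record Graph (n : ℕ) : Set where
  field
    adj    : Fin n → Fin n → Bool
    sym    : ∀ x y → adj x y ≡ adj y x
    irrefl : ∀ x → adj x x ≡ false
open Graph public

-- Raw adjacency functions (used so that edge deletion needs no proofs).
AdjFn : ℕ → Set
AdjFn n = Fin n → Fin n → Bool

-- Non-adjacency of distinct vertices, i.e. adjacency in the complement.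
CoAdj : ∀ {n} → AdjFn n → Fin n → Fin n → Set
CoAdj A x y = x ≢ y × A x y ≡ false

CoTriangleFree : ∀ {n} → AdjFn n → Set
CoTriangleFree A = ∀ x y z → ¬ (CoAdj A x y × CoAdj A y z × CoAdj A x z)

Co3Colorable : ∀ {n} → AdjFn n → Set
Co3Colorable {n} A = Σ (Fin n → Fin 3) λ c → ∀ x y → CoAdj A x y → c x ≢ c y

data Walk {n} (Γ : Graph n) : Fin n → Fin n → Set where
  [] : ∀ {x} → Walk Γ x x
  _∷_ : ∀ {x y z} → adj Γ x y ≡ true → Walk Γ y z → Walk Γ x z

Connected : ∀ {n} → Graph n → Set
Connected Γ = ∀ x y → Walk Γ x y

isPair : ∀ {n} → Fin n → Fin n → Fin n → Fin n → Bool
isPair a b x y = (⌊ x ≟ a ⌋ ∧ ⌊ y ≟ b ⌋) ∨ (⌊ x ≟ b ⌋ ∧ ⌊ y ≟ a ⌋)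

deleteEdge : ∀ {n} → Graph n → Fin n → Fin n → AdjFn n
deleteEdge Γ a b x y = if isPair a b x y then false else adj Γ x y

record MinimalPrime {n} (Γ : Graph n) : Set where
  field
    twoVertices  : 2 ≤ n
    connected    : Connected Γ
    triangleFree : CoTriangleFree (adj Γ)
    colorable    : Co3Colorable (adj Γ)
    minimal      : ∀ a b → adj Γ a b ≡ true →
                   ¬ (CoTriangleFree (deleteEdge Γ a b) × Co3Colorable (deleteEdge Γ a b))

-- Γ' = Γ plus a new vertex w (= zero) adjacent exactly to U (old vertex i is suc i).
inU : ∀ {n} → Subset n → Fin n → Bool
inU U i with lookup U i
... | inside  = true
... | outside = false

extAdj : ∀ {n} → Graph n → Subset n → AdjFn (suc n)
extAdj Γ U zero    zero    = false
extAdj Γ U zero    (suc j) = inU U j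
extAdj Γ U (suc i) zero    = inU U i
extAdj Γ U (suc i) (suc j) = adj Γ i j

extend : ∀ {n} → Graph n → Subset n → Graph (suc n)
extend Γ U = record { adj = extAdj Γ U ; sym = s ; irrefl = r }
  where
  s : ∀ x y → extAdj Γ U x y ≡ extAdj Γ U y x
  s zero zero = refl
  s zero (suc j) = refl
  s (suc i) zero = refl
  s (suc i) (suc j) = Graph.sym Γ i j
  r : ∀ x → extAdj Γ U x x ≡ false
  r zero = refl
  r (suc i) = Graph.irrefl Γ i

GenerationSite : ∀ {n} → Graph n → Subset n → Set
GenerationSite Γ U = MinimalPrime (extend Γ U)

IsClique : ∀ {n} → Graph n → (Fin n → Set) → Set
IsClique Γ K = ∀ x y → K x → K y → x ≢ y → adj Γ x y ≡ true

{-# OPTIONS --safe #-}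
-- In a graph with triangle-free complement, the non-neighbours of any vertex
-- are pairwise adjacent. In Γ' the non-neighbours of the new vertex w are
-- exactly the vertices outside U, and Γ' agrees with Γ on them.
module Submission where

open import Defs
open import Data.Fin using (Fin; zero; suc)
open import Data.Fin.Properties using (suc-injective)
open import Data.Fin.Subset using (Subset; _∉_; inside; outside)
open import Data.Vec using (lookup)
open import Data.Vec.Properties using (lookup⇒[]=)
open import Data.Bool using (true; false)
open import Data.Product using (_,_)
open import Data.Empty using (⊥-elim)
open import Relation.Binary.PropositionalEquality using (_≡_; refl)

inU-∉ : ∀ {n} (U : Subset n) {x : Fin n} → x ∉ U → inU U x ≡ false
inU-∉ U {x} x∉U with lookup U x in eq
... | inside  = ⊥-elim (x∉U (lookup⇒[]= x U eq))
... | outside = refl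

coNeighbourhood-isClique : ∀ {n} (Γ : Graph n) → CoTriangleFree (adj Γ) →
                           ∀ w → IsClique Γ (CoAdj (adj Γ) w)
coNeighbourhood-isClique Γ triangleFree w x y w≁x w≁y x≢y with adj Γ x y in x≁y
... | true  = refl
... | false = ⊥-elim (triangleFree w x y (w≁x , (x≢y , x≁y) , w≁y))

extend-coAdj-new : ∀ {n} (Γ : Graph n) (U : Subset n) {x : Fin n} →
                   x ∉ U → CoAdj (adj (extend Γ U)) zero (suc x)
extend-coAdj-new Γ U x∉U = (λ ()) , inU-∉ U x∉U

mainTheorem18 : ∀ {n} (Γ : Graph n) (U : Subset n) →
                MinimalPrime Γ → GenerationSite Γ U →
                IsClique Γ (λ v → v ∉ U)
mainTheorem18 Γ U _ site x y x∉U y∉U x≢y =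
  coNeighbourhood-isClique (extend Γ U) (MinimalPrime.triangleFree site) zero
    (suc x) (suc y)
    (extend-coAdj-new Γ U x∉U) (extend-coAdj-new Γ U y∉U)
    (λ sx≡sy → x≢y (suc-injective sx≡sy))
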